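{- Let $A$ be a finite alphabet, $c\ge 0$ an integer, and let $X\subseteq A^{\mathbb{Z}}$ be a subshift of finite type of order $n$. Then $X$ is $c$-block gluing if and only if for every pair $(u,v)$ of vertices of the Rauzy graph $G_n(X)$ there is a path of length $n+c-1$ from $u$ to $v$ in $G_n(X)$.
   Context: A subshift is a closed shift-invariant subset of $A^{\mathbb{Z}}$; $L_X$ is its language (finite words occurring in elements of $X$) and $L_X(m)$ the words of length $m$ in it. $X$ is $c$-block gluing if for all $u,v\in L_X$ and every integer $m\geq c$ there is a word $w$ with $|w|=m$ and $uwv\in L_X$. A subshift of finite type is one defined by a finite set of forbidden words; its order is the smallest integer $r$ such that it can be defined by a set of forbidden words of length $r$. The Rauzy graph $G_n(X)$ is the directed graph with vertex set $L_X(n-1)$, with an edge from $u=u_1\dots u_{n-1}$ to $v=v_1\dots v_{n-1}$ iff $u_2\dots u_{n-1}=v_1\dots v_{n-2}$ and $u_1\dots u_{n-1}v_{n-1}\in L_X(n)$; this edge is labelled by $v_{n-1}$. The length of a path is its number of edges. -}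

module Defs where

open import Data.Nat using (ℕ; zero; suc; _≤_; _∸_; _+_)
open import Data.Integer using (ℤ) renaming (_+_ to _+ℤ_; suc to sucℤ)
open import Data.List using (List; []; _∷_; _++_; [_]; length; drop)
open import Data.List.Relation.Unary.All using (All)
open import Data.List.Membership.Propositional using (_∈_)
open import Data.Product using (Σ; ∃; _×_; _,_)
open import Relation.Binary.PropositionalEquality using (_≡_)
open import Relation.Nullary using (¬_)
open import Function.Bundles using (_⇔_)

Subset : Set → Set₁
Subset A = (ℤ → A) → Set

window : {A : Set} → (ℤ → A) → ℤ → ℕ → List A
window x i zero    = []
window x i (suc m) = x i ∷ window x (sucℤ i) m

Lang : {A : Set} → Subset A → List A → Set
Lang X w = ∃ λ x → X x × ∃ λ i → window x i (length w) ≡ w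

BlockGluing : {A : Set} → Subset A → ℕ → Set
BlockGluing X c =
  ∀ (u v : List _) → Lang X u → Lang X v →
  ∀ (m : ℕ) → c ≤ m →
  ∃ λ w → length w ≡ m × Lang X (u ++ w ++ v)

DefinableBy : {A : Set} → Subset A → ℕ → Set
DefinableBy {A} X r =
  Σ (List (List A)) λ F →
    All (λ w → length w ≡ r) F ×
    (∀ x → X x ⇔ (∀ (i : ℤ) → ¬ (window x i r ∈ F)))

IsSFTOfOrder : {A : Set} → Subset A → ℕ → Set
IsSFTOfOrder X n =
  1 ≤ n × DefinableBy X n × (∀ r → 1 ≤ r → DefinableBy X r → n ≤ r)

Vertex : {A : Set} → Subset A → ℕ → List A → Set
Vertex X n u = length u ≡ n ∸ 1 × Lang X u

Edge : {A : Set} → Subset A → ℕ → List A → List A → Set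
Edge X n u v =
  Vertex X n u × Vertex X n v ×
  ∃ λ a → drop 1 (u ++ [ a ]) ≡ v × Lang X (u ++ [ a ])

data Path {A : Set} (X : Subset A) (n : ℕ) : ℕ → List A → List A → Set where
  here : ∀ {u} → Vertex X n u → Path X n 0 u u
  step : ∀ {ℓ u w v} → Edge X n u w → Path X n ℓ w v → Path X n (suc ℓ) u v

-- A path of length ℓ in G_n(X) from u to v is the same thing as a word of length
-- n - 1 + ℓ in L_X starting with u and ending with v: the edges say that consecutive
-- n-windows are allowed, and since X is defined by forbidden words of length n, a
-- sequence all of whose n-windows are allowed can be realised in a point of X by
-- splicing points of X along overlaps of length n - 1. So c-block gluing (a word
-- u w v with |w| = c for every u, v) is the existence of paths of length n - 1 + c
-- between any two vertices; longer gaps come from prolonging paths by any edge.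
module Submission where

open import Defs
open import Data.Nat using (ℕ; _+_; _∸_)
open import Data.Fin using (Fin)
open import Data.List using (List)
open import Function.Bundles using (_⇔_)

open import Data.Nat as ℕ using (zero; suc; _≤_)
import Data.Nat.Properties as ℕ
open import Data.Integer as ℤ using (ℤ; +_; 1ℤ)
import Data.Integer.Properties as ℤ
open import Data.Integer.Tactic.RingSolver using (solve-∀)
open import Data.List using ([]; _∷_; _++_; _∷ʳ_; length; drop)
open import Data.List.Properties using (length-++; ∷-injective; ∷ʳ-injectiveˡ)
open import Data.List.Membership.Propositional using (_∈_)
open import Data.Product using (∃; _×_; _,_; proj₁; proj₂)
open import Relation.Binary.PropositionalEquality hiding ([_])
open import Relation.Nullary using (¬_; yes; no; contradiction)
open import Function.Bundles using (Equivalence; mk⇔)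

suc[i]+j≡i+suc[j] : ∀ i j → (1ℤ ℤ.+ i) ℤ.+ j ≡ i ℤ.+ (1ℤ ℤ.+ j)
suc[i]+j≡i+suc[j] = solve-∀

i+j-i≡j : ∀ i j → i ℤ.+ j ℤ.- i ≡ j
i+j-i≡j = solve-∀

i+[j-i]≡j : ∀ i j → i ℤ.+ (j ℤ.- i) ≡ j
i+[j-i]≡j = solve-∀

i-j+j≡i : ∀ i j → i ℤ.- j ℤ.+ j ≡ i
i-j+j≡i = solve-∀

i+[a+b]≡i+a+b : ∀ i a b → i ℤ.+ + (a + b) ≡ i ℤ.+ + a ℤ.+ + b
i+[a+b]≡i+a+b i a b = trans (cong (λ j → i ℤ.+ j) (ℤ.pos-+ a b)) (sym (ℤ.+-assoc i (+ a) (+ b)))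

+-cancelˡ-< : ∀ r a b → r ℤ.+ + a ℤ.< r ℤ.+ + b → a ℕ.< b
+-cancelˡ-< r a b lt = ℤ.drop‿+<+ (subst₂ ℤ._<_ (cancel (+ a)) (cancel (+ b)) (ℤ.+-monoʳ-< (ℤ.- r) lt))
  where
  cancel : ∀ i → ℤ.- r ℤ.+ (r ℤ.+ i) ≡ i
  cancel i = trans (sym (ℤ.+-assoc (ℤ.- r) r i)) (trans (cong (ℤ._+ i) (ℤ.+-inverseˡ r)) (ℤ.+-identityˡ i))

++-injective : ∀ {A : Set} (a b c d : List A) → length a ≡ length b → a ++ c ≡ b ++ d → a ≡ b × c ≡ d
++-injective []      []      c d _ eq = refl , eq
++-injective (x ∷ a) (y ∷ b) c d l eq with ∷-injective eq
... | refl , e = let p , q = ++-injective a b c d (ℕ.suc-injective l) e in cong (x ∷_) p , q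

module _ {A : Set} where

  length-window : ∀ (x : ℤ → A) i m → length (window x i m) ≡ m
  length-window x i zero    = refl
  length-window x i (suc m) = cong suc (length-window x (ℤ.suc i) m)

  window-++ : ∀ (x : ℤ → A) i a b → window x i (a + b) ≡ window x i a ++ window x (i ℤ.+ + a) b
  window-++ x i zero    b = cong (λ j → window x j b) (sym (ℤ.+-identityʳ i))
  window-++ x i (suc a) b = cong (x i ∷_) (begin
    window x (ℤ.suc i) (a + b)                                   ≡⟨ window-++ x (ℤ.suc i) a b ⟩
    window x (ℤ.suc i) a ++ window x (ℤ.suc i ℤ.+ + a) b         ≡⟨ cong (λ j → window x (ℤ.suc i) a ++ window x j b) (suc[i]+j≡i+suc[j] i (+ a)) ⟩
    window x (ℤ.suc i) a ++ window x (i ℤ.+ + suc a) b           ∎)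
    where open ≡-Reasoning

  window-snoc : ∀ (x : ℤ → A) i m → window x i (suc m) ≡ window x i m ∷ʳ x (i ℤ.+ + m)
  window-snoc x i m = trans (cong (window x i) (ℕ.+-comm 1 m)) (window-++ x i m 1)

  window-split : ∀ (x : ℤ → A) i a b (u w : List A) → length u ≡ a →
                 window x i (a + b) ≡ u ++ w → window x i a ≡ u × window x (i ℤ.+ + a) b ≡ w
  window-split x i a b u w |u| eq =
    ++-injective _ _ _ _ (trans (length-window x i a) (sym |u|)) (trans (sym (window-++ x i a b)) eq)

  window-cong : ∀ (x y : ℤ → A) i j m → (∀ t → t ℕ.< m → x (i ℤ.+ + t) ≡ y (j ℤ.+ + t)) →
                window x i m ≡ window y j m
  window-cong x y i j zero    agree = refl
  window-cong x y i j (suc m) agree = cong₂ _∷_ head (window-cong x y (ℤ.suc i) (ℤ.suc j) m tail)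
    where
    head : x i ≡ y j
    head = subst₂ (λ a b → x a ≡ y b) (ℤ.+-identityʳ i) (ℤ.+-identityʳ j) (agree 0 (ℕ.s≤s ℕ.z≤n))
    tail : ∀ t → t ℕ.< m → x (ℤ.suc i ℤ.+ + t) ≡ y (ℤ.suc j ℤ.+ + t)
    tail t t<m = subst₂ (λ a b → x a ≡ y b) (sym (suc[i]+j≡i+suc[j] i (+ t))) (sym (suc[i]+j≡i+suc[j] j (+ t)))
                        (agree (suc t) (ℕ.s≤s t<m))

  window-pointwise : ∀ (x y : ℤ → A) i j m → window x i m ≡ window y j m →
                     ∀ t → t ℕ.< m → x (i ℤ.+ + t) ≡ y (j ℤ.+ + t)
  window-pointwise x y i j (suc m) eq zero _ = subst₂ (λ a b → x a ≡ y b)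
    (sym (ℤ.+-identityʳ i)) (sym (ℤ.+-identityʳ j)) (proj₁ (∷-injective eq))
  window-pointwise x y i j (suc m) eq (suc t) (ℕ.s≤s t<m) = subst₂ (λ a b → x a ≡ y b)
    (suc[i]+j≡i+suc[j] i (+ t)) (suc[i]+j≡i+suc[j] j (+ t))
    (window-pointwise x y (ℤ.suc i) (ℤ.suc j) m (proj₂ (∷-injective eq)) t t<m)

  window∈Lang : ∀ {X : Subset A} {x} → X x → ∀ i m → Lang X (window x i m)
  window∈Lang {x = x} Xx i m = x , Xx , i , cong (window x i) (length-window x i m)

Joined : {A : Set} → Subset A → ℕ → ℕ → Set
Joined X n ℓ = ∀ u v → Vertex X n u → Vertex X n v → Path X n ℓ u v

module Rauzy {A : Set} {X : Subset A} {n′ : ℕ} (X-def : DefinableBy X (suc n′)) where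

  n : ℕ
  n = suc n′

  F : List (List A)
  F = proj₁ X-def

  X⇔allowed : ∀ x → X x ⇔ (∀ i → ¬ (window x i n ∈ F))
  X⇔allowed = proj₂ (proj₂ X-def)

  -- x up to position r + n′, then y, aligned so that x at r and y at r′ coincide.
  splice : (x y : ℤ → A) → ℤ → ℤ → ℤ → A
  splice x y r r′ k with k ℤ.<? r ℤ.+ + n′
  ... | yes _ = x k
  ... | no  _ = y (r′ ℤ.+ (k ℤ.- r))

  splice-left : ∀ x y r r′ k → k ℤ.< r ℤ.+ + n′ → splice x y r r′ k ≡ x k
  splice-left x y r r′ k k< with k ℤ.<? r ℤ.+ + n′
  ... | yes _  = refl
  ... | no k≮ = contradiction k< k≮

  splice-right : ∀ x y r r′ → window x r n′ ≡ window y r′ n′ →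
                 ∀ t → splice x y r r′ (r ℤ.+ + t) ≡ y (r′ ℤ.+ + t)
  splice-right x y r r′ agree t with r ℤ.+ + t ℤ.<? r ℤ.+ + n′
  ... | yes t< = window-pointwise x y r r′ n′ agree t (+-cancelˡ-< r t n′ t<)
  ... | no  _  = cong (λ s → y (r′ ℤ.+ s)) (i+j-i≡j r (+ t))

  -- Every n-window of the splice is an n-window of x or of y.
  splice∈X : ∀ {x y} r r′ → X x → X y → window x r n′ ≡ window y r′ n′ → X (splice x y r r′)
  splice∈X {x} {y} r r′ Xx Xy agree = Equivalence.from (X⇔allowed z) allowed
    where
    z : ℤ → A
    z = splice x y r r′
    allowed : ∀ i → ¬ (window z i n ∈ F)
    allowed i with i ℤ.<? r
    ... | yes i<r = subst (λ w → ¬ (w ∈ F)) (sym z≡x) (Equivalence.to (X⇔allowed x) Xx i)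
      where
      z≡x : window z i n ≡ window x i n
      z≡x = window-cong z x i i n (λ t t<n → splice-left x y r r′ (i ℤ.+ + t)
              (ℤ.≤-<-trans (ℤ.+-monoʳ-≤ i (ℤ.+≤+ (ℕ.≤-pred t<n))) (ℤ.+-monoˡ-< (+ n′) i<r)))
    ... | no  i≮r = subst (λ w → ¬ (w ∈ F)) (sym z≡y) (Equivalence.to (X⇔allowed y) Xy (r′ ℤ.+ + d))
      where
      d : ℕ
      d = ℤ.∣ i ℤ.- r ∣
      i≡r+d : i ≡ r ℤ.+ + d
      i≡r+d = sym (trans (cong (λ j → r ℤ.+ j) (ℤ.0≤i⇒+∣i∣≡i (ℤ.i≤j⇒0≤j-i (ℤ.≮⇒≥ i≮r)))) (i+[j-i]≡j r i))
      z≡y : window z i n ≡ window y (r′ ℤ.+ + d) n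
      z≡y = window-cong z y i (r′ ℤ.+ + d) n (λ t _ → begin
        z (i ℤ.+ + t)                ≡⟨ cong (λ j → z (j ℤ.+ + t)) i≡r+d ⟩
        z (r ℤ.+ + d ℤ.+ + t)        ≡⟨ cong z (sym (i+[a+b]≡i+a+b r d t)) ⟩
        z (r ℤ.+ + (d + t))          ≡⟨ splice-right x y r r′ agree (d + t) ⟩
        y (r′ ℤ.+ + (d + t))         ≡⟨ cong y (i+[a+b]≡i+a+b r′ d t) ⟩
        y (r′ ℤ.+ + d ℤ.+ + t)       ∎)
        where open ≡-Reasoning

  splice-window-suc : ∀ x y r r′ → window x r n′ ≡ window y r′ n′ →
                      window (splice x y r r′) (ℤ.suc r) n′ ≡ window y (ℤ.suc r′) n′
  splice-window-suc x y r r′ agree = window-cong _ y (ℤ.suc r) (ℤ.suc r′) n′ λ t _ →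
    trans (cong (splice x y r r′) (suc[i]+j≡i+suc[j] r (+ t)))
          (trans (splice-right x y r r′ agree (suc t)) (cong y (sym (suc[i]+j≡i+suc[j] r′ (+ t)))))

  window-vertex : ∀ {x} → X x → ∀ i → Vertex X n (window x i n′)
  window-vertex Xx i = length-window _ i n′ , window∈Lang Xx i n′

  window-edge : ∀ {x} → X x → ∀ i → Edge X n (window x i n′) (window x (ℤ.suc i) n′)
  window-edge {x} Xx i = window-vertex Xx i , window-vertex Xx (ℤ.suc i) , x (i ℤ.+ + n′) ,
    cong (drop 1) (sym (window-snoc x i n′)) ,
    subst (Lang X) (window-snoc x i n′) (window∈Lang Xx i n)

  window-path : ∀ {x} → X x → ∀ i ℓ → Path X n ℓ (window x i n′) (window x (i ℤ.+ + ℓ) n′)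
  window-path {x} Xx i zero =
    subst (λ j → Path X n 0 (window x i n′) (window x j n′)) (sym (ℤ.+-identityʳ i)) (here (window-vertex Xx i))
  window-path {x} Xx i (suc ℓ) = step (window-edge Xx i)
    (subst (λ j → Path X n ℓ (window x (ℤ.suc i) n′) (window x j n′)) (suc[i]+j≡i+suc[j] i (+ ℓ))
      (window-path Xx (ℤ.suc i) ℓ))

  edge-occurrence : ∀ {u w} → Edge X n u w →
                    ∃ λ y → X y × ∃ λ j → window y j n′ ≡ u × window y (ℤ.suc j) n′ ≡ w
  edge-occurrence {u} ((|u| , _) , _ , a , shift , y , Xy , j , occ) =
    y , Xy , j , ∷ʳ-injectiveˡ _ _ (trans (sym (window-snoc y j n′)) occ′) , trans (cong (drop 1) occ′) shift
    where
    |ua| : length (u ∷ʳ a) ≡ n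
    |ua| = trans (length-++ u) (trans (cong (_+ 1) |u|) (ℕ.+-comm n′ 1))
    occ′ : window y j n ≡ u ∷ʳ a
    occ′ = trans (cong (window y j) (sym |ua|)) occ

  -- Each edge is witnessed by a point, which is spliced on along the shared n′-window.
  realise : ∀ {ℓ u v} → Path X n ℓ u v → ∀ {x y q j} → X x → X y →
            window x q n′ ≡ u → window y j n′ ≡ v →
            ∃ λ z → X z × (∀ k → k ℤ.< q ℤ.+ + n′ → z k ≡ x k)
                        × (∀ t → z (q ℤ.+ + ℓ ℤ.+ + t) ≡ y (j ℤ.+ + t))
  realise (here _) {x} {y} {q} {j} Xx Xy x≡u y≡u =
    splice x y q j , splice∈X q j Xx Xy agree , splice-left x y q j ,
    λ t → trans (cong (λ s → splice x y q j (s ℤ.+ + t)) (ℤ.+-identityʳ q)) (splice-right x y q j agree t)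
    where
    agree : window x q n′ ≡ window y j n′
    agree = trans x≡u (sym y≡u)
  realise (step {ℓ} e p) {x} {y} {q} {j} Xx Xy x≡u y≡v =
    let y₀ , Xy₀ , j₀ , y₀≡u , y₀≡w = edge-occurrence e
        agree = trans x≡u (sym y₀≡u)
        z , Xz , z≈x₁ , z≈y = realise p (splice∈X q j₀ Xx Xy₀ agree) Xy
                                (trans (splice-window-suc x y₀ q j₀ agree) y₀≡w) y≡v
    in z , Xz ,
       (λ k k< → trans (z≈x₁ k (ℤ.<-≤-trans k< (ℤ.+-monoˡ-≤ (+ n′) (ℤ.i≤j+i q 1ℤ))))
                       (splice-left x y₀ q j₀ k k<)) ,
       λ t → trans (cong (λ s → z (s ℤ.+ + t)) (sym (suc[i]+j≡i+suc[j] q (+ ℓ)))) (z≈y t)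

  joined-+ : ∀ d {ℓ} → Joined X n ℓ → Joined X n (d + ℓ)
  joined-+ zero    joined = joined
  joined-+ (suc d) {ℓ} joined u v (|u| , x , Xx , i , occ) v-vertex =
    subst (λ u → Path X n (suc d + ℓ) u v) (trans (cong (window x i) (sym |u|)) occ)
      (step (window-edge Xx i) (joined-+ d joined _ v (window-vertex Xx (ℤ.suc i)) v-vertex))

  joined-mono : ∀ {ℓ ℓ′} → ℓ ≤ ℓ′ → Joined X n ℓ → Joined X n ℓ′
  joined-mono ℓ≤ℓ′ joined with ℕ.m≤n⇒∃[o]m+o≡n ℓ≤ℓ′
  ... | d , refl = subst (Joined X n) (ℕ.+-comm d _) (joined-+ d joined)

  blockGluing⇒joined : ∀ c → BlockGluing X c → Joined X n (n′ + c)
  blockGluing⇒joined c glue u v (|u| , Lu) (|v| , Lv) with glue u v Lu Lv c ℕ.≤-refl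
  ... | w , |w| , x , Xx , i , occ =
    subst₂ (Path X n (n′ + c)) x≡u x≡v (window-path Xx i (n′ + c))
    where
    |uwv| : length (u ++ w ++ v) ≡ n′ + (c + n′)
    |uwv| = trans (length-++ u) (cong₂ _+_ |u| (trans (length-++ w) (cong₂ _+_ |w| |v|)))
    split-u : window x i n′ ≡ u × window x (i ℤ.+ + n′) (c + n′) ≡ w ++ v
    split-u = window-split x i n′ (c + n′) u (w ++ v) |u| (trans (cong (window x i) (sym |uwv|)) occ)
    x≡u : window x i n′ ≡ u
    x≡u = proj₁ split-u
    x≡v : window x (i ℤ.+ + (n′ + c)) n′ ≡ v
    x≡v = trans (cong (λ s → window x s n′) (i+[a+b]≡i+a+b i n′ c))
                (proj₂ (window-split x (i ℤ.+ + n′) c n′ w v |w| (proj₂ split-u)))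

  glue-points : ∀ {ℓ} → Joined X n ℓ → ∀ {x y} → X x → X y → ∀ q j →
                ∃ λ z → X z × (∀ k → k ℤ.< q ℤ.+ + n′ → z k ≡ x k)
                            × (∀ t → z (q ℤ.+ + ℓ ℤ.+ + t) ≡ y (j ℤ.+ + t))
  glue-points joined Xx Xy q j =
    realise (joined _ _ (window-vertex Xx q) (window-vertex Xy j)) Xx Xy refl refl

  joined⇒blockGluing : ∀ c → Joined X n (n′ + c) → BlockGluing X c
  joined⇒blockGluing c joined u v (x , Xx , i , x≡u) (y , Xy , j , y≡v) m c≤m
    with glue-points (joined-mono (ℕ.+-monoʳ-≤ n′ c≤m) joined) Xx Xy (i ℤ.+ + length u ℤ.- + n′) j
  ... | z , Xz , z≈x , z≈y = w , length-window z gap m , z , Xz , i , z≡uwv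
    where
    gap : ℤ
    gap = i ℤ.+ + length u
    q : ℤ
    q = gap ℤ.- + n′
    w : List A
    w = window z gap m
    q+n′≡gap : q ℤ.+ + n′ ≡ gap
    q+n′≡gap = i-j+j≡i gap (+ n′)
    z≡u : window z i (length u) ≡ u
    z≡u = trans (window-cong z x i i (length u) (λ t t<|u| →
            z≈x (i ℤ.+ + t)
              (subst (i ℤ.+ + t ℤ.<_) (sym q+n′≡gap) (ℤ.+-monoʳ-< i (ℤ.+<+ t<|u|))))) x≡u
    z≡v : window z (gap ℤ.+ + m) (length v) ≡ v
    z≡v = trans (cong (λ s → window z s (length v))
                  (trans (cong (ℤ._+ + m) (sym q+n′≡gap)) (sym (i+[a+b]≡i+a+b q n′ m))))
                (trans (window-cong z y _ j (length v) (λ t _ → z≈y t)) y≡v)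
    z≡uwv : window z i (length (u ++ w ++ v)) ≡ u ++ w ++ v
    z≡uwv = begin
      window z i (length (u ++ w ++ v))
        ≡⟨ cong (window z i) (trans (length-++ u) (cong (λ s → length u + s) (trans (length-++ w)
             (cong (_+ length v) (length-window z gap m))))) ⟩
      window z i (length u + (m + length v))
        ≡⟨ window-++ z i (length u) (m + length v) ⟩
      window z i (length u) ++ window z gap (m + length v)
        ≡⟨ cong (window z i (length u) ++_) (window-++ z gap m (length v)) ⟩
      window z i (length u) ++ w ++ window z (gap ℤ.+ + m) (length v)
        ≡⟨ cong₂ (λ s s′ → s ++ w ++ s′) z≡u z≡v ⟩
      u ++ w ++ v ∎
      where open ≡-Reasoning

mainTheorem6 : (k c n : ℕ) (X : Subset (Fin k)) → IsSFTOfOrder X n →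
    (BlockGluing X c ⇔
    (∀ (u v : List (Fin k)) → Vertex X n u → Vertex X n v →
    Path X n (n + c ∸ 1) u v))
mainTheorem6 k c zero     X (() , _)
mainTheorem6 k c (suc n′) X (_ , X-def , _) = mk⇔ (blockGluing⇒joined c) (joined⇒blockGluing c)
  where open Rauzy X-def
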